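{- For every $n\ge1$, the map $\sigma\mapsto\bar\sigma$ is a bijection of $\mathfrak S_n$ onto itself satisfying $E\sigma=M\bar\sigma$ for all $\sigma\in\mathfrak S_n$.
   Context: $[n]=\{1,\dots,n\}$, $\mathfrak S_n$ the symmetric group on $[n]$, with product $(\sigma\tau)(k)=\sigma(\tau(k))$; $x_+=\max\{0,x\}$. For $\sigma\in\mathfrak S_n$: $E\sigma\in\mathbb N^n$, $E\sigma(k)=(\sigma(k)-(k-1))_+$; with the conventions $\sigma^{ -1}(0)=0$ and $\sigma(n+1)=0$, $M\sigma\in\mathbb N^n$, $M\sigma(k)=(\sigma(\sigma^{ -1}(k-1)+1)-(k-1))_+$. Let $\zeta\in\mathfrak S_n$ be given by $\zeta(k)=k+1$ for $k<n$ and $\zeta(n)=1$. For $\tau\in\mathfrak S_n$, $\tilde\tau(k)=\tau(n+1-k)$. The map $\tau\mapsto\hat\tau$: for $k\in[n]$ let $\bar k$ be the maximum of the $\tau$-orbit of $k$, $q_k=\min\{p\ge0:\tau^p(k)=\bar k\}$, $\Pi_\tau(k)=(\bar k,q_k)$; $\hat\tau$ is the unique permutation with $\Pi_\tau(\hat\tau(1)),\dots,\Pi_\tau(\hat\tau(n))$ lexicographically increasing. Finally, for $\sigma\in\mathfrak S_n$, put $\sigma_1=\sigma\zeta$, $\sigma_2=\hat{\sigma_1}$ and $\bar\sigma=\tilde{\sigma_2}$. -}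

module Defs where

open import Data.Nat using (ℕ; zero; suc; _+_; _∸_; _⊔_; _<_; _≟_; _<?_)
open import Data.Fin using (Fin; toℕ; opposite; fromℕ<)
import Data.Fin
open import Data.Fin.Properties using () renaming (_≟_ to _≟ᶠ_)
open import Data.List using (List; []; _∷_; map; foldr; filter; length; upTo; allFin)
open import Data.Product using (_×_; _,_)
open import Data.Sum using (_⊎_)
open import Relation.Binary.PropositionalEquality using (_≡_)
open import Relation.Nullary using (yes; no; Dec)
open import Relation.Nullary.Decidable using (_⊎-dec_; _×-dec_)
open import Function using (_∘_)
open import Function.Definitions using (Bijective)

-- Conventions: a permutation of [n] is a bijection Fin n → Fin n.
-- The element i : Fin n stands for the number toℕ i + 1 ∈ [n] (0-based encoding).

Perm-fun : ℕ → Set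
Perm-fun n = Fin n → Fin n

IsPerm : ∀ {n} → Perm-fun n → Set
IsPerm σ = Bijective _≡_ _≡_ σ

-- E σ (k) = (σ(k) - (k-1))_+ ; with k = i+1 and σ(k) = toℕ (σ i) + 1.
E : ∀ {n} → Perm-fun n → Fin n → ℕ
E σ i = (toℕ (σ i) + 1) ∸ toℕ i


-- 1-based value σ(m) for a 1-based position m ∈ {1..n+1}, with σ(n+1) = 0.
-- Given as a function of a 0-based position p ∈ {0..n}: value at p (0 if p = n).
valAt : ∀ {n} → Perm-fun n → ℕ → ℕ
valAt {n} σ p with p <? n
... | yes p<n = toℕ (σ (fromℕ< p<n)) + 1
... | no _ = 0

-- 0-based inverse: position of value v (search; default 0 if not found)
invSearch : ∀ {n} → Perm-fun n → ℕ → ℕ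
invSearch {n} σ v = go (allFin n)
  where
  go : List (Fin n) → ℕ
  go [] = 0
  go (j ∷ js) with toℕ (σ j) ≟ v
  ... | yes _ = toℕ j
  ... | no _ = go js

-- M σ (k) = (σ(σ⁻¹(k-1)+1) - (k-1))_+  with σ⁻¹(0) = 0 and σ(n+1) = 0.
-- For k = i+1: if i = 0 then σ⁻¹(0) = 0 so the value is σ(1) (0-based position 0);
-- otherwise σ⁻¹(k-1) is the 1-based position (invSearch σ (i-1)) + 1, and the
-- next 1-based position has 0-based index invSearch σ (i-1) + 1.
M : ∀ {n} → Perm-fun n → Fin n → ℕ
M σ i with toℕ i
... | zero = valAt σ 0 ∸ 0
... | suc i' = valAt σ (invSearch σ i' + 1) ∸ suc i'

ζ : ∀ {n} → Perm-fun n
ζ {zero} ()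
ζ {suc n} i with suc (toℕ i) <? suc n
... | yes p = fromℕ< p
... | no _ = Data.Fin.zero

tilde : ∀ {n} → Perm-fun n → Perm-fun n
tilde τ = τ ∘ opposite

iter : ∀ {n} → Perm-fun n → ℕ → Fin n → Fin n
iter τ zero k = k
iter τ (suc p) k = τ (iter τ p k)

orbitMax : ∀ {n} → Perm-fun n → Fin n → ℕ
orbitMax {n} τ k = foldr _⊔_ 0 (map (λ p → toℕ (iter τ p k)) (upTo n))

-- q_k = min {p ≥ 0 : τ^p(k) = k̄}  (searched among p < n, which suffices for permutations)
qOf : ∀ {n} → Perm-fun n → Fin n → ℕ
qOf {n} τ k = go (upTo n)
  where
  go : List ℕ → ℕ
  go [] = 0
  go (p ∷ ps) with toℕ (iter τ p k) ≟ orbitMax τ k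
  ... | yes _ = p
  ... | no _ = go ps

_<lex_ : ℕ × ℕ → ℕ × ℕ → Set
(a , b) <lex (c , d) = a < c ⊎ (a ≡ c × b < d)

Π : ∀ {n} → Perm-fun n → Fin n → ℕ × ℕ
Π τ k = orbitMax τ k , qOf τ k

-- rank of k = number of j with Π j <lex Π k  (0-based position of k in the sorted order)
rank : ∀ {n} → Perm-fun n → Fin n → ℕ
rank {n} τ k = length (filter (λ j → lexDec (Π τ j) (Π τ k)) (allFin n))
  where
  lexDec : (x y : ℕ × ℕ) → Dec (x <lex y)
  lexDec (a , b) (c , d) = (a <? c) ⊎-dec ((a ≟ c) ×-dec (b <? d))

-- τ̂(i) = the unique k of rank i (so Π(τ̂ 1) , … , Π(τ̂ n) increase lexicographically)
hat : ∀ {n} → Perm-fun n → Perm-fun n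
hat {n} τ i = go (allFin n)
  where
  go : List (Fin n) → Fin n
  go [] = i
  go (k ∷ ks) with rank τ k ≟ toℕ i
  ... | yes _ = k
  ... | no _ = go ks

bar : ∀ {n} → Perm-fun n → Perm-fun n
bar σ = tilde (hat (σ ∘ ζ))

-- Write τ = σζ. Sorting by (orbit maximum, distance to it) makes hat τ list
-- each cycle of τ as c, τ⁻¹c, τ⁻²c, … from its maximum c, cycles by increasing
-- maximum; so σ̄ lists the cycles by decreasing maximum, each as τc, τ²c, …, c.
-- Reading σ̄ from left to right, the letter after a non-maximal v is τ v = σ(v+1),
-- the letter after a cycle maximum is smaller than it (or absent), and the first
-- letter is τ n = σ 1; unfolding E and M, this is E σ = M σ̄.
-- σ̄ also determines σ: the orbit maximum of the letter at position j is the
-- largest letter at or after j, which fixes τ away from the maxima, and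
-- injectivity of τ fixes it at the maxima. Finally σ ↦ σ̄ is an injective self-map
-- of the finite set of permutations, hence onto.
module Submission where

open import Defs
open import Data.Nat using (ℕ; zero; suc; _+_; _*_; _∸_; _⊔_; _<_; _≤_; _≥_; _≟_; _<?_; z≤n; s≤s)
open import Data.Nat.Properties
open import Data.Nat.DivMod using (_%_; _/_; m≡m%n+[m/n]*n; m%n<n)
open import Data.Fin as Fin using (Fin; toℕ; fromℕ; fromℕ<; inject₁; opposite)
open import Data.Fin.Relation.Unary.Top using (view; ‵fromℕ; ‵inject₁)
open import Data.Fin.Properties
  using (all?; toℕ-injective; toℕ<n; toℕ≤pred[n]; toℕ-fromℕ; toℕ-fromℕ<; fromℕ<-toℕ; toℕ-inject₁;
         opposite-prop; opposite-involutive; pigeonhole; punchOut-injective; injective⇒≤; any?)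
  renaming (_≟_ to _≟ᶠ_)
open import Data.List as List using (List; []; _∷_; [_]; map; foldr; filter; length; upTo; applyUpTo; allFin; cartesianProductWith)
open import Data.List.Properties using (filter-notAll; length-tabulate)
open import Data.List.Membership.Propositional using (_∈_)
open import Data.List.Membership.Propositional.Properties
  using (∈-allFin; ∈-map⁺; ∈-map⁻; ∈-upTo⁺; ∈-upTo⁻; foldr-selective; ∈-lookup; ∈-cartesianProductWith⁺;
         ∈-filter⁺; ∈-filter⁻)
open import Data.List.Relation.Unary.Unique.Propositional using (Unique)
open import Data.List.Relation.Unary.Unique.Propositional.Properties using (cartesianProductWith⁺; allFin⁺; filter⁺)
open import Data.List.Relation.Unary.AllPairs using ([]; _∷_)
open import Data.List.Relation.Unary.Any.Properties using (lookup-index)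
import Data.List.Relation.Unary.All as All
open import Data.Vec as Vec using (Vec; tabulate)
open import Data.Vec.Properties using (∷-injective; lookup∘tabulate; tabulate∘lookup; tabulate-cong)
open import Data.List.Relation.Unary.Any using (here; there)
import Data.List.Relation.Unary.Any as Any
open import Data.Product using (_×_; _,_; ∃; proj₁; proj₂)
open import Data.Sum using (_⊎_; inj₁; inj₂)
open import Data.Empty using (⊥; ⊥-elim)
open import Function using (_∘_; id)
open import Function.Definitions using (Injective)
open import Relation.Binary using (tri<; tri≈; tri>)
open import Relation.Binary.PropositionalEquality
  using (_≡_; _≢_; _≗_; refl; sym; trans; cong; cong₂; subst; subst₂; module ≡-Reasoning)
open import Relation.Nullary using (Dec; yes; no; ¬_; contradiction)
open import Relation.Nullary.Decidable using (_⊎-dec_; _×-dec_; _→-dec_; map′)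
open import Relation.Unary using (Pred; Decidable)
open import Level using (0ℓ)

-- Defs computes qOf, hat and invSearch by linear searches bound in where
-- blocks; each search is given a name here by letting Agda solve for it.
mutual
  qOf′ : ∀ {n} → Perm-fun n → Fin n → List ℕ → ℕ
  qOf′ = _

  qOf≡qOf′ : ∀ {n} (τ : Perm-fun n) k → qOf τ k ≡ qOf′ τ k (upTo n)
  qOf≡qOf′ {n} τ k with applyUpTo id n
  ... | _ = refl

mutual
  hat′ : ∀ {n} → Perm-fun n → Fin n → List (Fin n) → Fin n
  hat′ = _

  hat≡hat′ : ∀ {n} (τ : Perm-fun n) i → hat τ i ≡ hat′ τ i (allFin n)
  hat≡hat′ {n} τ i with allFin n
  ... | _ = refl

mutual
  invSearch′ : ∀ {n} → Perm-fun n → ℕ → List (Fin n) → ℕ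
  invSearch′ = _

  invSearch≡invSearch′ : ∀ {n} (σ : Perm-fun n) v → invSearch σ v ≡ invSearch′ σ v (allFin n)
  invSearch≡invSearch′ {n} σ v with allFin n
  ... | _ = refl

injective⇒surjective : ∀ {n} {f : Fin n → Fin n} → Injective _≡_ _≡_ f → ∀ y → ∃ λ x → f x ≡ y
injective⇒surjective {suc n} {f} f-inj y with any? (λ x → f x ≟ᶠ y)
... | yes hit = hit
... | no miss = contradiction (injective⇒≤ punchOut∘f-injective) (<-irrefl refl)
  where
  y≢f : ∀ x → y ≢ f x
  y≢f x y≡fx = miss (x , sym y≡fx)

  punchOut∘f-injective : Injective _≡_ _≡_ (λ x → Fin.punchOut (y≢f x))
  punchOut∘f-injective eq = f-inj (punchOut-injective (y≢f _) (y≢f _) eq)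

injective⇒bijective : ∀ {n} {f : Fin n → Fin n} → Injective _≡_ _≡_ f → IsPerm f
injective⇒bijective f-inj =
  f-inj , λ y → proj₁ (injective⇒surjective f-inj y) , λ { refl → proj₂ (injective⇒surjective f-inj y) }

lookup-injective : ∀ {A : Set} {xs : List A} → Unique xs → Injective _≡_ _≡_ (List.lookup xs)
lookup-injective {xs = x ∷ xs} (x∉xs ∷ xs-unique) {Fin.zero} {Fin.zero} _ = refl
lookup-injective {xs = x ∷ xs} (x∉xs ∷ xs-unique) {Fin.zero} {Fin.suc j} eq = contradiction eq (All.lookup x∉xs (∈-lookup j))
lookup-injective {xs = x ∷ xs} (x∉xs ∷ xs-unique) {Fin.suc i} {Fin.zero} eq = contradiction (sym eq) (All.lookup x∉xs (∈-lookup i))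
lookup-injective {xs = x ∷ xs} (x∉xs ∷ xs-unique) {Fin.suc i} {Fin.suc j} eq = cong Fin.suc (lookup-injective xs-unique eq)

module _ {A : Set} {xs : List A} (xs-unique : Unique xs) {f : A → A} (f-∈ : ∀ {x} → x ∈ xs → f x ∈ xs)
         (f-injective : ∀ {x y} → x ∈ xs → y ∈ xs → f x ≡ f y → x ≡ y) where

  private
    position : Fin (length xs) → Fin (length xs)
    position i = Any.index (f-∈ (∈-lookup i))

    f-lookup : ∀ i → f (List.lookup xs i) ≡ List.lookup xs (position i)
    f-lookup i = lookup-index (f-∈ (∈-lookup i))

    position-injective : Injective _≡_ _≡_ position
    position-injective {i} {j} pi≡pj = lookup-injective xs-unique (f-injective (∈-lookup i) (∈-lookup j)
      (trans (f-lookup i) (trans (cong (List.lookup xs) pi≡pj) (sym (f-lookup j)))))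

  selfMap-surjective : ∀ {y} → y ∈ xs → ∃ λ x → x ∈ xs × f x ≡ y
  selfMap-surjective {y} y∈xs with i , pi≡y ← injective⇒surjective position-injective (Any.index y∈xs) =
    List.lookup xs i , ∈-lookup i , trans (f-lookup i) (trans (cong (List.lookup xs) pi≡y) (sym (lookup-index y∈xs)))

injective? : ∀ {n} (f : Fin n → Fin n) → Dec (Injective _≡_ _≡_ f)
injective? f = map′ (λ inj {i} {j} → inj i j) (λ inj i j → inj)
                    (all? λ i → all? λ j → (f i ≟ᶠ f j) →-dec (i ≟ᶠ j))

module _ {n : ℕ} where

  vectors : ∀ k → List (Vec (Fin n) k)
  vectors zero = [ Vec.[] ]
  vectors (suc k) = cartesianProductWith Vec._∷_ (allFin n) (vectors k)

  ∈-vectors : ∀ {k} (v : Vec (Fin n) k) → v ∈ vectors k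
  ∈-vectors Vec.[] = here refl
  ∈-vectors (a Vec.∷ v) = ∈-cartesianProductWith⁺ Vec._∷_ (∈-allFin a) (∈-vectors v)

  vectors-unique : ∀ k → Unique (vectors k)
  vectors-unique zero = All.[] ∷ []
  vectors-unique (suc k) = cartesianProductWith⁺ Vec._∷_ ∷-injective (allFin⁺ n) (vectors-unique k)

  opaque
    permVectors : List (Vec (Fin n) n)
    permVectors = filter (injective? ∘ Vec.lookup) (vectors n)

    permVectors-unique : Unique permVectors
    permVectors-unique = filter⁺ (injective? ∘ Vec.lookup) (vectors-unique n)

    tabulate∈permVectors : ∀ {f : Fin n → Fin n} → Injective _≡_ _≡_ f → tabulate f ∈ permVectors
    tabulate∈permVectors {f} f-injective = ∈-filter⁺ (injective? ∘ Vec.lookup) (∈-vectors (tabulate f))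
      λ {i} {j} eq → f-injective (trans (sym (lookup∘tabulate f i)) (trans eq (lookup∘tabulate f j)))

    ∈-permVectors⁻ : ∀ {v} → v ∈ permVectors → Injective _≡_ _≡_ (Vec.lookup v)
    ∈-permVectors⁻ v∈ = proj₂ (∈-filter⁻ (injective? ∘ Vec.lookup) {xs = vectors n} v∈)

≤-foldr-⊔ : ∀ {x xs} → x ∈ xs → x ≤ foldr _⊔_ 0 xs
≤-foldr-⊔ (here refl) = m≤m⊔n _ _
≤-foldr-⊔ (there x∈xs) = m≤n⇒m≤o⊔n _ (≤-foldr-⊔ x∈xs)

module _ {A : Set} {P Q : Pred A 0ℓ} (P? : Decidable P) (Q? : Decidable Q) (P⊆Q : ∀ {x} → P x → Q x) where

  length-filter-mono : ∀ xs → length (filter P? xs) ≤ length (filter Q? xs)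
  length-filter-mono [] = z≤n
  length-filter-mono (x ∷ xs) with P? x | Q? x
  ... | yes _  | yes _  = s≤s (length-filter-mono xs)
  ... | yes px | no ¬qx = contradiction (P⊆Q px) ¬qx
  ... | no _   | yes _  = m≤n⇒m≤1+n (length-filter-mono xs)
  ... | no _   | no _   = length-filter-mono xs

  length-filter-strictMono : ∀ {z xs} → z ∈ xs → ¬ P z → Q z → length (filter P? xs) < length (filter Q? xs)
  length-filter-strictMono {xs = x ∷ xs} z∈ ¬pz qz with P? x | Q? x | z∈
  ... | yes px | no ¬qx | _          = contradiction (P⊆Q px) ¬qx
  ... | yes _  | yes _  | there z∈xs = s≤s (length-filter-strictMono z∈xs ¬pz qz)
  ... | yes px | yes _  | here refl  = contradiction px ¬pz
  ... | no _   | yes _  | _          = s≤s (length-filter-mono xs)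
  ... | no _   | no ¬qx | here refl  = contradiction qz ¬qx
  ... | no _   | no _   | there z∈xs = length-filter-strictMono z∈xs ¬pz qz

-- Definitionally the decision procedure bound inside rank, so rank τ x is a filter by _<lex?_.
_<lex?_ : (x y : ℕ × ℕ) → Dec (x <lex y)
(a , b) <lex? (c , d) = (a <? c) ⊎-dec ((a ≟ c) ×-dec (b <? d))

<lex-irrefl : ∀ {x} → ¬ (x <lex x)
<lex-irrefl (inj₁ a<a) = <-irrefl refl a<a
<lex-irrefl (inj₂ (_ , b<b)) = <-irrefl refl b<b

<lex-trans : ∀ {x y z} → x <lex y → y <lex z → x <lex z
<lex-trans (inj₁ a<c) (inj₁ c<e) = inj₁ (<-trans a<c c<e)
<lex-trans (inj₁ a<c) (inj₂ (refl , _)) = inj₁ a<c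
<lex-trans (inj₂ (refl , _)) (inj₁ c<e) = inj₁ c<e
<lex-trans (inj₂ (refl , b<d)) (inj₂ (refl , d<f)) = inj₂ (refl , <-trans b<d d<f)

<lex-cmp : ∀ x y → x <lex y ⊎ y <lex x ⊎ x ≡ y
<lex-cmp (a , b) (c , d) with <-cmp a c
... | tri< a<c _ _ = inj₁ (inj₁ a<c)
... | tri> _ _ c<a = inj₂ (inj₁ (inj₁ c<a))
... | tri≈ _ refl _ with <-cmp b d
...   | tri< b<d _ _ = inj₁ (inj₂ (refl , b<d))
...   | tri> _ _ d<b = inj₂ (inj₁ (inj₂ (refl , d<b)))
...   | tri≈ _ refl _ = inj₂ (inj₂ refl)

<lex-no-between : ∀ {a b x} → (a , b) <lex x → x <lex (a , suc b) → ⊥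
<lex-no-between (inj₁ a<c) (inj₁ c<a) = <-asym a<c c<a
<lex-no-between (inj₁ a<a) (inj₂ (refl , _)) = <-irrefl refl a<a
<lex-no-between (inj₂ (refl , _)) (inj₁ a<a) = <-irrefl refl a<a
<lex-no-between (inj₂ (refl , b<d)) (inj₂ (_ , d<1+b)) = <-irrefl refl (<-≤-trans b<d (≤-pred d<1+b))

ζ-inject₁ : ∀ {m} (k : Fin m) → ζ (inject₁ k) ≡ Fin.suc k
ζ-inject₁ {m} k with suc (toℕ (inject₁ k)) <? suc m
... | yes k+1<n = toℕ-injective (trans (toℕ-fromℕ< k+1<n) (cong suc (toℕ-inject₁ k)))
... | no k+1≮n = contradiction (s≤s (subst (_< m) (sym (toℕ-inject₁ k)) (toℕ<n k))) k+1≮n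

ζ-fromℕ : ∀ m → ζ (fromℕ m) ≡ Fin.zero
ζ-fromℕ m with suc (toℕ (fromℕ m)) <? suc m
... | yes m+1<m+1 = contradiction (subst (λ k → suc k < suc m) (toℕ-fromℕ m) m+1<m+1) (<-irrefl refl)
... | no _ = refl

ζ⁻¹ : ∀ {m} → Fin (suc m) → Fin (suc m)
ζ⁻¹ Fin.zero = fromℕ _
ζ⁻¹ (Fin.suc k) = inject₁ k

ζ-ζ⁻¹ : ∀ {m} (i : Fin (suc m)) → ζ (ζ⁻¹ i) ≡ i
ζ-ζ⁻¹ Fin.zero = ζ-fromℕ _
ζ-ζ⁻¹ (Fin.suc k) = ζ-inject₁ k

ζ⁻¹-ζ : ∀ {m} (i : Fin (suc m)) → ζ⁻¹ (ζ i) ≡ i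
ζ⁻¹-ζ i with view i
... | ‵fromℕ = cong ζ⁻¹ (ζ-fromℕ _)
... | ‵inject₁ k = cong ζ⁻¹ (ζ-inject₁ k)

ζ-injective : ∀ {m} → Injective _≡_ _≡_ (ζ {suc m})
ζ-injective {x = i} {j} ζi≡ζj = trans (sym (ζ⁻¹-ζ i)) (trans (cong ζ⁻¹ ζi≡ζj) (ζ⁻¹-ζ j))

valAt-toℕ : ∀ {n} (σ : Perm-fun n) j → valAt σ (toℕ j) ≡ toℕ (σ j) + 1
valAt-toℕ {n} σ j with toℕ j <? n
... | yes j<n = cong (λ k → toℕ (σ k) + 1) (fromℕ<-toℕ j j<n)
... | no j≮n = contradiction (toℕ<n j) j≮n

valAt-suc : ∀ {n} (σ : Perm-fun n) {j j′ : Fin n} → toℕ j′ ≡ suc (toℕ j) → valAt σ (suc (toℕ j)) ≡ toℕ (σ j′) + 1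
valAt-suc σ {j′ = j′} j′≡j+1 = trans (cong (valAt σ) (sym j′≡j+1)) (valAt-toℕ σ j′)

valAt-cong : ∀ {n} {σ σ′ : Perm-fun n} → σ ≗ σ′ → ∀ p → valAt σ p ≡ valAt σ′ p
valAt-cong {n} σ≗σ′ p with p <? n
... | yes p<n = cong (λ x → toℕ x + 1) (σ≗σ′ (fromℕ< p<n))
... | no _ = refl

valAt-≤ : ∀ {n} (σ : Perm-fun n) p {b} → (∀ j → toℕ j ≡ p → toℕ (σ j) < b) → valAt σ p ≤ b
valAt-≤ {n} σ p bound with p <? n
... | yes p<n = ≤-trans (≤-reflexive (+-comm _ 1)) (bound (fromℕ< p<n) (toℕ-fromℕ< p<n))
... | no _ = z≤n

invSearch-correct : ∀ {n} {σ : Perm-fun n} → Injective _≡_ _≡_ σ → ∀ x → invSearch σ (toℕ (σ x)) ≡ toℕ x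
invSearch-correct {n} {σ} σ-inj x = trans (invSearch≡invSearch′ σ _) (search (allFin n) (∈-allFin x))
  where
  search : ∀ xs → x ∈ xs → invSearch′ σ (toℕ (σ x)) xs ≡ toℕ x
  search (j ∷ js) x∈ with toℕ (σ j) ≟ toℕ (σ x) | x∈
  ... | yes σj≡σx | _ = cong toℕ (σ-inj (toℕ-injective σj≡σx))
  ... | no σj≢σx | here refl = contradiction refl σj≢σx
  ... | no _ | there x∈js = search js x∈js

IsSuffixMax : ∀ {n} → (Fin n → ℕ) → Fin n → ℕ → Set
IsSuffixMax f j b = (∀ j′ → toℕ j ≤ toℕ j′ → f j′ ≤ b) × ∃ λ j′ → toℕ j ≤ toℕ j′ × f j′ ≡ b

suffixMax-unique : ∀ {n} {f g : Fin n → ℕ} {j a b} → f ≗ g → IsSuffixMax f j a → IsSuffixMax g j b → a ≡ b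
suffixMax-unique f≗g (f≤a , j₁ , j≤j₁ , fj₁≡a) (g≤b , j₂ , j≤j₂ , gj₂≡b) = ≤-antisym
  (subst (_≤ _) fj₁≡a (≤-trans (≤-reflexive (f≗g j₁)) (g≤b j₁ j≤j₁)))
  (subst (_≤ _) gj₂≡b (≤-trans (≤-reflexive (sym (f≗g j₂))) (f≤a j₂ j≤j₂)))

module Cycles {m : ℕ} (τ : Perm-fun (suc m)) (τ-injective : Injective _≡_ _≡_ τ) where

  iter-+ : ∀ a b x → iter τ (a + b) x ≡ iter τ a (iter τ b x)
  iter-+ zero b x = refl
  iter-+ (suc a) b x = cong τ (iter-+ a b x)

  iter-suc : ∀ p x → iter τ (suc p) x ≡ iter τ p (τ x)
  iter-suc zero x = refl
  iter-suc (suc p) x = cong τ (iter-suc p x)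

  iter-injective : ∀ p → Injective _≡_ _≡_ (iter τ p)
  iter-injective zero eq = eq
  iter-injective (suc p) eq = iter-injective p (τ-injective eq)

  period : ∀ x → ∃ λ d → d ≤ m × iter τ (suc d) x ≡ x
  period x = d , d≤m , sym (iter-injective (toℕ i) (trans τⁱx≡τʲx τʲx≡τⁱτᵈ⁺¹x))
    where
    collision = pigeonhole ≤-refl (λ (k : Fin (suc (suc m))) → iter τ (toℕ k) x)
    i = proj₁ collision
    j = proj₁ (proj₂ collision)
    i<j = proj₁ (proj₂ (proj₂ collision))
    τⁱx≡τʲx = proj₂ (proj₂ (proj₂ collision))
    d = toℕ j ∸ suc (toℕ i)
    i+1+d≡j : toℕ i + suc d ≡ toℕ j
    i+1+d≡j = trans (+-suc (toℕ i) d) (m+[n∸m]≡n i<j)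
    d≤m : d ≤ m
    d≤m = ≤-pred (≤-trans (m≤n+m (suc d) (toℕ i)) (≤-trans (≤-reflexive i+1+d≡j) (toℕ≤pred[n] j)))
    τʲx≡τⁱτᵈ⁺¹x : iter τ (toℕ j) x ≡ iter τ (toℕ i) (iter τ (suc d) x)
    τʲx≡τⁱτᵈ⁺¹x = trans (cong (λ k → iter τ k x) (sym i+1+d≡j)) (iter-+ (toℕ i) (suc d) x)

  iter-periodic : ∀ {d x} → iter τ d x ≡ x → ∀ k → iter τ (k * d) x ≡ x
  iter-periodic τᵈx≡x zero = refl
  iter-periodic {d} {x} τᵈx≡x (suc k) = begin
    iter τ (d + k * d) x       ≡⟨ iter-+ d (k * d) x ⟩
    iter τ d (iter τ (k * d) x) ≡⟨ cong (iter τ d) (iter-periodic τᵈx≡x k) ⟩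
    iter τ d x                 ≡⟨ τᵈx≡x ⟩
    x                          ∎
    where open ≡-Reasoning

  iter-reduce : ∀ p x → ∃ λ r → r < suc m × iter τ p x ≡ iter τ r x
  iter-reduce p x with d , d≤m , τᵈ⁺¹x≡x ← period x =
    p % suc d , ≤-trans (m%n<n p (suc d)) (s≤s d≤m) , (begin
      iter τ p x                                      ≡⟨ cong (λ k → iter τ k x) (m≡m%n+[m/n]*n p (suc d)) ⟩
      iter τ (p % suc d + p / suc d * suc d) x         ≡⟨ iter-+ (p % suc d) _ x ⟩
      iter τ (p % suc d) (iter τ (p / suc d * suc d) x) ≡⟨ cong (iter τ (p % suc d)) (iter-periodic τᵈ⁺¹x≡x (p / suc d)) ⟩
      iter τ (p % suc d) x                            ∎)
    where open ≡-Reasoning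

  iter≤orbitMax : ∀ p x → toℕ (iter τ p x) ≤ orbitMax τ x
  iter≤orbitMax p x with r , r<n , τᵖx≡τʳx ← iter-reduce p x =
    subst (λ y → toℕ y ≤ orbitMax τ x) (sym τᵖx≡τʳx)
          (≤-foldr-⊔ (∈-map⁺ (λ k → toℕ (iter τ k x)) (∈-upTo⁺ r<n)))

  ≤orbitMax : ∀ x → toℕ x ≤ orbitMax τ x
  ≤orbitMax = iter≤orbitMax 0

  orbitMax-attained : ∀ x → ∃ λ p → p < suc m × toℕ (iter τ p x) ≡ orbitMax τ x
  orbitMax-attained x with foldr-selective ⊔-sel 0 (map (λ k → toℕ (iter τ k x)) (upTo (suc m)))
  ... | inj₁ max≡0 = 0 , s≤s z≤n , trans (n≤0⇒n≡0 (subst (toℕ x ≤_) max≡0 (≤orbitMax x))) (sym max≡0)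
  ... | inj₂ max∈ with p , p∈ , max≡τᵖx ← ∈-map⁻ (λ k → toℕ (iter τ k x)) max∈ = p , ∈-upTo⁻ p∈ , sym max≡τᵖx

  orbitMax-τ-≤ : ∀ x → orbitMax τ (τ x) ≤ orbitMax τ x
  orbitMax-τ-≤ x with p , _ , τᵖτx≡max ← orbitMax-attained (τ x) =
    subst₂ _≤_ (trans (cong toℕ (iter-suc p x)) τᵖτx≡max) refl (iter≤orbitMax (suc p) x)

  orbitMax-iter-≤ : ∀ p x → orbitMax τ (iter τ p x) ≤ orbitMax τ x
  orbitMax-iter-≤ zero x = ≤-refl
  orbitMax-iter-≤ (suc p) x = ≤-trans (orbitMax-τ-≤ (iter τ p x)) (orbitMax-iter-≤ p x)

  orbitMax-τ : ∀ x → orbitMax τ (τ x) ≡ orbitMax τ x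
  orbitMax-τ x with d , _ , τᵈ⁺¹x≡x ← period x =
    ≤-antisym (orbitMax-τ-≤ x)
              (subst (λ y → orbitMax τ y ≤ orbitMax τ (τ x)) (trans (sym (iter-suc d x)) τᵈ⁺¹x≡x)
                     (orbitMax-iter-≤ d (τ x)))

  orbitMax-iter : ∀ p x → orbitMax τ (iter τ p x) ≡ orbitMax τ x
  orbitMax-iter zero x = refl
  orbitMax-iter (suc p) x = trans (orbitMax-τ (iter τ p x)) (orbitMax-iter p x)

  IsOrbitMax : Fin (suc m) → Set
  IsOrbitMax x = toℕ x ≡ orbitMax τ x

  ReachesMaxAt : Fin (suc m) → ℕ → Set
  ReachesMaxAt x p = toℕ (iter τ p x) ≡ orbitMax τ x

  qOf′-applyUpTo : ∀ x g k → (∃ λ j → j < k × ReachesMaxAt x (g j)) →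
                   ∃ λ j → qOf′ τ x (applyUpTo g k) ≡ g j × ReachesMaxAt x (g j)
                         × (∀ i → i < j → ¬ ReachesMaxAt x (g i))
  qOf′-applyUpTo x g (suc k) hit with toℕ (iter τ (g 0) x) ≟ orbitMax τ x | hit
  ... | yes reaches | _ = 0 , refl , reaches , λ _ ()
  ... | no misses | zero , _ , reaches = contradiction reaches misses
  ... | no misses | suc j , s≤s j<k , reaches
    with j′ , found , reaches′ , before ← qOf′-applyUpTo x (g ∘ suc) k (j , j<k , reaches) =
    suc j′ , found , reaches′ , λ { zero _ → misses ; (suc i) (s≤s i<j′) → before i i<j′ }

  qOf-least : ∀ x → ReachesMaxAt x (qOf τ x) × (∀ p → p < qOf τ x → ¬ ReachesMaxAt x p)
  qOf-least x
    with p , p<n , reaches ← orbitMax-attained x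
    with j , found , reachesʲ , before ← qOf′-applyUpTo x id (suc m) (p , p<n , reaches)
    rewrite qOf≡qOf′ τ x | found = reachesʲ , before

  qOf-unique : ∀ x p → ReachesMaxAt x p → (∀ i → i < p → ¬ ReachesMaxAt x i) → qOf τ x ≡ p
  qOf-unique x p reaches before with qOf-least x | <-cmp (qOf τ x) p
  ... | reachesq , _ | tri< q<p _ _ = contradiction reachesq (before _ q<p)
  ... | _ | tri≈ _ q≡p _ = q≡p
  ... | _ , beforeq | tri> _ _ p<q = contradiction reaches (beforeq p p<q)

  qOf-max : ∀ {x} → IsOrbitMax x → qOf τ x ≡ 0
  qOf-max {x} x-max = qOf-unique x 0 x-max λ _ ()

  qOf-τ : ∀ {x} → ¬ IsOrbitMax x → qOf τ x ≡ suc (qOf τ (τ x))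
  qOf-τ {x} x-nonmax with qOf τ x | qOf-least x
  ... | zero | reaches , _ = contradiction reaches x-nonmax
  ... | suc q | reaches , before = cong suc (sym (qOf-unique (τ x) q reachesτx beforeτx))
    where
    shift : ∀ p → ReachesMaxAt (τ x) p ≡ ReachesMaxAt x (suc p)
    shift p = cong₂ _≡_ (cong toℕ (sym (iter-suc p x))) (orbitMax-τ x)
    reachesτx : ReachesMaxAt (τ x) q
    reachesτx = subst id (sym (shift q)) reaches
    beforeτx : ∀ i → i < q → ¬ ReachesMaxAt (τ x) i
    beforeτx i i<q = before (suc i) (s≤s i<q) ∘ subst id (shift i)

  Π-injective : ∀ {x y} → Π τ x ≡ Π τ y → x ≡ y
  Π-injective {x} {y} Πx≡Πy = iter-injective (qOf τ x) (toℕ-injective (begin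
    toℕ (iter τ (qOf τ x) x) ≡⟨ proj₁ (qOf-least x) ⟩
    orbitMax τ x             ≡⟨ cong proj₁ Πx≡Πy ⟩
    orbitMax τ y             ≡⟨ sym (proj₁ (qOf-least y)) ⟩
    toℕ (iter τ (qOf τ y) y) ≡⟨ cong (λ q → toℕ (iter τ q y)) (sym (cong proj₂ Πx≡Πy)) ⟩
    toℕ (iter τ (qOf τ x) y) ∎))
    where open ≡-Reasoning

  rank-<lex : ∀ {x y} → Π τ x <lex Π τ y → rank τ x < rank τ y
  rank-<lex {x} {y} Πx<Πy =
    length-filter-strictMono (λ j → Π τ j <lex? Π τ x) (λ j → Π τ j <lex? Π τ y)
                             (λ Πj<Πx → <lex-trans Πj<Πx Πx<Πy) (∈-allFin x) <lex-irrefl Πx<Πy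

  rank<n : ∀ x → rank τ x < suc m
  rank<n x = subst (rank τ x <_) (length-tabulate id)
    (filter-notAll (λ j → Π τ j <lex? Π τ x) (allFin (suc m)) (Any.map (λ { refl → <lex-irrefl }) (∈-allFin x)))

  rank-injective : ∀ {x y} → rank τ x ≡ rank τ y → x ≡ y
  rank-injective {x} {y} rx≡ry with <lex-cmp (Π τ x) (Π τ y)
  ... | inj₁ Πx<Πy = contradiction rx≡ry (<⇒≢ (rank-<lex Πx<Πy))
  ... | inj₂ (inj₁ Πy<Πx) = contradiction (sym rx≡ry) (<⇒≢ (rank-<lex Πy<Πx))
  ... | inj₂ (inj₂ Πx≡Πy) = Π-injective Πx≡Πy

  opaque
    rankFin : Fin (suc m) → Fin (suc m)
    rankFin x = fromℕ< (rank<n x)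

    toℕ-rankFin : ∀ x → toℕ (rankFin x) ≡ rank τ x
    toℕ-rankFin x = toℕ-fromℕ< (rank<n x)

  rankFin-injective : Injective _≡_ _≡_ rankFin
  rankFin-injective {x} {y} eq = rank-injective (trans (sym (toℕ-rankFin x)) (trans (cong toℕ eq) (toℕ-rankFin y)))

  hat-unique : ∀ i y → rank τ y ≡ toℕ i → hat τ i ≡ y
  hat-unique i y ry≡i = trans (hat≡hat′ τ i) (search (allFin (suc m)) (∈-allFin y))
    where
    search : ∀ xs → y ∈ xs → hat′ τ i xs ≡ y
    search (k ∷ ks) y∈ with rank τ k ≟ toℕ i | y∈
    ... | yes rk≡i | _ = rank-injective (trans rk≡i (sym ry≡i))
    ... | no rk≢i | here refl = contradiction ry≡i rk≢i
    ... | no _ | there y∈ks = search ks y∈ks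

  hat-rankFin : ∀ y → hat τ (rankFin y) ≡ y
  hat-rankFin y = hat-unique (rankFin y) y (sym (toℕ-rankFin y))

  rank-hat : ∀ i → rank τ (hat τ i) ≡ toℕ i
  rank-hat i =
    let y , rankFin-y≡i = injective⇒surjective rankFin-injective i
    in begin
      rank τ (hat τ i)            ≡⟨ cong (λ k → rank τ (hat τ k)) {i} {rankFin y} (sym rankFin-y≡i) ⟩
      rank τ (hat τ (rankFin y))  ≡⟨ cong (rank τ) {hat τ (rankFin y)} {y} (hat-rankFin y) ⟩
      rank τ y                    ≡⟨ sym (toℕ-rankFin y) ⟩
      toℕ (rankFin y)             ≡⟨ cong toℕ rankFin-y≡i ⟩
      toℕ i                       ∎
    where open ≡-Reasoning

  orbitMax≤m : ∀ x → orbitMax τ x ≤ m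
  orbitMax≤m x with p , _ , τᵖx≡max ← orbitMax-attained x = subst (_≤ m) τᵖx≡max (toℕ≤pred[n] (iter τ p x))

  Π-nonmax : ∀ {x} → ¬ IsOrbitMax x → Π τ x ≡ (orbitMax τ (τ x) , suc (qOf τ (τ x)))
  Π-nonmax {x} x-nonmax = cong₂ _,_ (sym (orbitMax-τ x)) (qOf-τ x-nonmax)

  Π-τ-<lex : ∀ {x} → ¬ IsOrbitMax x → Π τ (τ x) <lex Π τ x
  Π-τ-<lex {x} x-nonmax = subst (Π τ (τ x) <lex_) (sym (Π-nonmax x-nonmax)) (inj₂ (refl , ≤-refl))

  <lex-Π-max : ∀ {x z} → IsOrbitMax z → Π τ x <lex Π τ z → orbitMax τ x < orbitMax τ z
  <lex-Π-max z-max (inj₁ Ox<Oz) = Ox<Oz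
  <lex-Π-max {x} z-max (inj₂ (_ , qx<qz)) = contradiction (subst (qOf τ x <_) (qOf-max z-max) qx<qz) λ ()

  -- Opaque, like rankFin and permVectors: letting unification unfold these
  -- searches is prohibitively expensive.
  opaque
    listing : Perm-fun (suc m)
    listing = tilde (hat τ)

    listing-hat : ∀ j → listing j ≡ hat τ (opposite j)
    listing-hat j = refl

  rank-listing : ∀ j → rank τ (listing j) ≡ m ∸ toℕ j
  rank-listing j = trans (cong (rank τ) (listing-hat j)) (trans (rank-hat (opposite j)) (opposite-prop j))

  listing-injective : Injective _≡_ _≡_ listing
  listing-injective {j} {j′} Lj≡Lj′ = toℕ-injective (∸-cancelˡ-≡ (toℕ≤pred[n] j) (toℕ≤pred[n] j′)
    (trans (sym (rank-listing j)) (trans (cong (rank τ) Lj≡Lj′) (rank-listing j′))))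

  listing-surjective : ∀ y → ∃ λ j → listing j ≡ y
  listing-surjective y =
    opposite (rankFin y) ,
    trans (listing-hat (opposite (rankFin y))) (trans (cong (hat τ) (opposite-involutive (rankFin y))) (hat-rankFin y))

  listing-Π-anti⁻ : ∀ {j j′} → Π τ (listing j′) <lex Π τ (listing j) → toℕ j < toℕ j′
  listing-Π-anti⁻ {j} {j′} Π<Π = ≰⇒> λ j′≤j →
    <⇒≱ (subst₂ _<_ (rank-listing j′) (rank-listing j) (rank-<lex Π<Π)) (∸-monoʳ-≤ m j′≤j)

  listing-Π-anti : ∀ {j j′} → toℕ j < toℕ j′ → Π τ (listing j′) <lex Π τ (listing j)
  listing-Π-anti {j} {j′} j<j′ with <lex-cmp (Π τ (listing j′)) (Π τ (listing j))
  ... | inj₁ Π<Π = Π<Π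
  ... | inj₂ (inj₁ Π>Π) = contradiction (listing-Π-anti⁻ Π>Π) (<-asym j<j′)
  ... | inj₂ (inj₂ Π≡Π) =
    contradiction (cong toℕ (listing-injective (Π-injective {listing j′} {listing j} Π≡Π))) (<⇒≢ j<j′ ∘ sym)

  orbitMax-listing-anti : ∀ {j j′} → toℕ j ≤ toℕ j′ → orbitMax τ (listing j′) ≤ orbitMax τ (listing j)
  orbitMax-listing-anti {j} {j′} j≤j′ with toℕ j ≟ toℕ j′
  ... | yes j≡j′ = ≤-reflexive (cong (orbitMax τ ∘ listing) (toℕ-injective (sym j≡j′)))
  ... | no j≢j′ with listing-Π-anti (≤∧≢⇒< j≤j′ j≢j′)
  ...   | inj₁ O<O = <⇒≤ O<O
  ...   | inj₂ (O≡O , _) = ≤-reflexive O≡O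

  listing-next : ∀ {j} → ¬ IsOrbitMax (listing j) → ∃ λ j′ → toℕ j′ ≡ suc (toℕ j) × listing j′ ≡ τ (listing j)
  listing-next {j} v-nonmax with j′ , Lj′≡τv ← listing-surjective (τ (listing j)) with toℕ j′ ≟ suc (toℕ j)
  ... | yes j′≡j+1 = j′ , j′≡j+1 , Lj′≡τv
  ... | no j′≢j+1 = ⊥-elim (<lex-no-between Πτv<Πk (subst (Π τ (listing k) <lex_) (Π-nonmax v-nonmax) Πk<Πv))
    where
    Πτv<Πv : Π τ (listing j′) <lex Π τ (listing j)
    Πτv<Πv = subst (λ y → Π τ y <lex Π τ (listing j)) (sym Lj′≡τv) (Π-τ-<lex v-nonmax)
    j+1<j′ : suc (toℕ j) < toℕ j′
    j+1<j′ = ≤∧≢⇒< (listing-Π-anti⁻ Πτv<Πv) (j′≢j+1 ∘ sym)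
    j+1<n : suc (toℕ j) < suc m
    j+1<n = <-trans j+1<j′ (toℕ<n j′)
    k : Fin (suc m)
    k = fromℕ< j+1<n
    k≡j+1 : toℕ k ≡ suc (toℕ j)
    k≡j+1 = toℕ-fromℕ< j+1<n
    Πk<Πv : Π τ (listing k) <lex Π τ (listing j)
    Πk<Πv = listing-Π-anti (≤-reflexive (sym k≡j+1))
    Πτv<Πk : Π τ (τ (listing j)) <lex Π τ (listing k)
    Πτv<Πk = subst (λ y → Π τ y <lex Π τ (listing k)) Lj′≡τv
               (listing-Π-anti (subst (_< toℕ j′) (sym k≡j+1) j+1<j′))

  listing-next-max : ∀ {j j′} → IsOrbitMax (listing j) → toℕ j′ ≡ suc (toℕ j) → toℕ (listing j′) < toℕ (listing j)
  listing-next-max {j} {j′} v-max j′≡j+1 = begin-strict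
    toℕ (listing j′)          ≤⟨ ≤orbitMax (listing j′) ⟩
    orbitMax τ (listing j′)   <⟨ <lex-Π-max v-max (listing-Π-anti (≤-reflexive (sym j′≡j+1))) ⟩
    orbitMax τ (listing j)    ≡⟨ sym v-max ⟩
    toℕ (listing j)           ∎
    where open ≤-Reasoning

  orbitMax-listing-suffixMax : ∀ j → IsSuffixMax (toℕ ∘ listing) j (orbitMax τ (listing j))
  orbitMax-listing-suffixMax j = bounded , attained
    where
    bounded : ∀ j′ → toℕ j ≤ toℕ j′ → toℕ (listing j′) ≤ orbitMax τ (listing j)
    bounded j′ j≤j′ = ≤-trans (≤orbitMax (listing j′)) (orbitMax-listing-anti j≤j′)
    attained : ∃ λ j′ → toℕ j ≤ toℕ j′ × toℕ (listing j′) ≡ orbitMax τ (listing j)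
    attained with p , _ , z≡max ← orbitMax-attained (listing j)
             with j′ , Lj′≡z ← listing-surjective (iter τ p (listing j)) =
      j′ , ≮⇒≥ j′≮j , trans (cong toℕ Lj′≡z) z≡max
      where
      z-max : IsOrbitMax (iter τ p (listing j))
      z-max = trans z≡max (sym (orbitMax-iter p (listing j)))
      j′≮j : ¬ toℕ j′ < toℕ j
      j′≮j j′<j = <-irrefl (sym (orbitMax-iter p (listing j)))
        (<lex-Π-max z-max (subst (λ z → Π τ (listing j) <lex Π τ z) Lj′≡z (listing-Π-anti j′<j)))

  listing-first : listing Fin.zero ≡ τ (fromℕ m)
  listing-first with y , τy≡L0 ← injective⇒surjective τ-injective (listing Fin.zero) with toℕ y ≟ orbitMax τ y
  ... | no y-nonmax =
    ⊥-elim (listing-zero-maximal (subst (λ x → Π τ x <lex Π τ y) τy≡L0 (Π-τ-<lex y-nonmax)))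
    where
    listing-zero-maximal : ∀ {x} → ¬ (Π τ (listing Fin.zero) <lex Π τ x)
    listing-zero-maximal {x} Π0<Πx with j , Lj≡x ← listing-surjective x =
      contradiction (listing-Π-anti⁻ (subst (λ x → Π τ (listing Fin.zero) <lex Π τ x) (sym Lj≡x) Π0<Πx)) λ ()
  ... | yes y-max = trans (sym τy≡L0) (cong τ (toℕ-injective (begin
    toℕ y                      ≡⟨ y-max ⟩
    orbitMax τ y               ≡⟨ sym (orbitMax-τ y) ⟩
    orbitMax τ (τ y)           ≡⟨ cong (orbitMax τ) τy≡L0 ⟩
    orbitMax τ (listing Fin.zero) ≡⟨ ≤-antisym (orbitMax≤m (listing Fin.zero)) m≤O ⟩
    m                          ≡⟨ sym (toℕ-fromℕ m) ⟩
    toℕ (fromℕ m)              ∎)))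
    where
    open ≡-Reasoning
    m≤O : m ≤ orbitMax τ (listing Fin.zero)
    m≤O with j , Lj≡top ← listing-surjective (fromℕ m) =
      ≤-trans (≤-reflexive (sym (toℕ-fromℕ m)))
        (≤-trans (≤orbitMax (fromℕ m))
                 (subst (λ x → orbitMax τ x ≤ orbitMax τ (listing Fin.zero)) Lj≡top (orbitMax-listing-anti z≤n)))

module _ {m : ℕ} {σ : Perm-fun (suc m)} (σ-injective : Injective _≡_ _≡_ σ) where

  σζ-injective : Injective _≡_ _≡_ (σ ∘ ζ)
  σζ-injective = ζ-injective ∘ σ-injective

  open Cycles (σ ∘ ζ) σζ-injective

  bar≗listing : bar σ ≗ listing
  bar≗listing j = sym (listing-hat j)

  bar-preservesInjective : Injective _≡_ _≡_ (bar σ)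
  bar-preservesInjective {i} {j} eq = listing-injective (trans (sym (bar≗listing i)) (trans eq (bar≗listing j)))

  excess-next : ∀ j → valAt listing (suc (toℕ j)) ∸ suc (toℕ (listing j))
                    ≡ toℕ (σ (ζ (listing j))) + 1 ∸ suc (toℕ (listing j))
  excess-next j with toℕ (listing j) ≟ orbitMax (σ ∘ ζ) (listing j)
  ... | no v-nonmax =
    let j′ , j′≡j+1 , Lj′≡τv = listing-next v-nonmax
    in cong (_∸ suc (toℕ (listing j)))
            (trans (valAt-suc listing j′≡j+1) (cong (λ x → toℕ x + 1) Lj′≡τv))
  ... | yes v-max = trans (m≤n⇒m∸n≡0 next≤) (sym (m≤n⇒m∸n≡0 τv≤))
    where
    next≤ : valAt listing (suc (toℕ j)) ≤ suc (toℕ (listing j))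
    next≤ = valAt-≤ listing (suc (toℕ j)) λ j′ j′≡j+1 → m<n⇒m<1+n (listing-next-max v-max j′≡j+1)
    τv≤ : toℕ (σ (ζ (listing j))) + 1 ≤ suc (toℕ (listing j))
    τv≤ = ≤-trans (≤-reflexive (+-comm (toℕ (σ (ζ (listing j)))) 1)) (s≤s (begin
      toℕ (σ (ζ (listing j)))                ≤⟨ ≤orbitMax (σ (ζ (listing j))) ⟩
      orbitMax (σ ∘ ζ) (σ (ζ (listing j)))   ≡⟨ orbitMax-τ (listing j) ⟩
      orbitMax (σ ∘ ζ) (listing j)           ≡⟨ sym v-max ⟩
      toℕ (listing j)                        ∎))
      where open ≤-Reasoning

  E≡M∘bar-suc : ∀ k j → listing j ≡ inject₁ k → E σ (Fin.suc k) ≡ M (bar σ) (Fin.suc k)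
  E≡M∘bar-suc k j Lj≡v = begin
    toℕ (σ (Fin.suc k)) + 1 ∸ suc (toℕ k)
      ≡⟨ cong₂ (λ x n → toℕ (σ x) + 1 ∸ suc n) (sym ζLj≡k+1) (sym Lj≡k) ⟩
    toℕ (σ (ζ (listing j))) + 1 ∸ suc (toℕ (listing j))
      ≡⟨ sym (excess-next j) ⟩
    valAt listing (suc (toℕ j)) ∸ suc (toℕ (listing j))
      ≡⟨ cong₂ (λ p n → valAt listing p ∸ suc n) (sym position) Lj≡k ⟩
    valAt listing (invSearch (bar σ) (toℕ k) + 1) ∸ suc (toℕ k)
      ≡⟨ cong (_∸ suc (toℕ k)) (valAt-cong (sym ∘ bar≗listing) (invSearch (bar σ) (toℕ k) + 1)) ⟩
    valAt (bar σ) (invSearch (bar σ) (toℕ k) + 1) ∸ suc (toℕ k)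
      ∎
    where
    open ≡-Reasoning
    Lj≡k : toℕ (listing j) ≡ toℕ k
    Lj≡k = trans (cong toℕ Lj≡v) (toℕ-inject₁ k)
    ζLj≡k+1 : ζ (listing j) ≡ Fin.suc k
    ζLj≡k+1 = trans (cong ζ Lj≡v) (ζ-inject₁ k)
    position : invSearch (bar σ) (toℕ k) + 1 ≡ suc (toℕ j)
    position = begin
      invSearch (bar σ) (toℕ k) + 1            ≡⟨ cong (λ v → invSearch (bar σ) v + 1) (sym (trans (cong toℕ (bar≗listing j)) Lj≡k)) ⟩
      invSearch (bar σ) (toℕ (bar σ j)) + 1    ≡⟨ cong (_+ 1) (invSearch-correct bar-preservesInjective j) ⟩
      toℕ j + 1                                ≡⟨ +-comm (toℕ j) 1 ⟩
      suc (toℕ j)                              ∎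

  E≗M∘bar : E σ ≗ M (bar σ)
  E≗M∘bar Fin.zero = cong (λ x → toℕ x + 1) (sym (begin
    bar σ Fin.zero        ≡⟨ bar≗listing Fin.zero ⟩
    listing Fin.zero      ≡⟨ listing-first ⟩
    σ (ζ (fromℕ m))       ≡⟨ cong σ (ζ-fromℕ m) ⟩
    σ Fin.zero            ∎))
    where open ≡-Reasoning
  E≗M∘bar (Fin.suc k) = let j , Lj≡v = listing-surjective (inject₁ k) in E≡M∘bar-suc k j Lj≡v

module _ {m : ℕ} {σ σ′ : Perm-fun (suc m)} (σ-injective : Injective _≡_ _≡_ σ) (σ′-injective : Injective _≡_ _≡_ σ′)
         (listings-agree : Cycles.listing (σ ∘ ζ) (σζ-injective σ-injective) ≗ Cycles.listing (σ′ ∘ ζ) (σζ-injective σ′-injective))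
         where

  private
    module A = Cycles (σ ∘ ζ) (σζ-injective σ-injective)
    module B = Cycles (σ′ ∘ ζ) (σζ-injective σ′-injective)

  orbitMax-agree : ∀ x → orbitMax (σ ∘ ζ) x ≡ orbitMax (σ′ ∘ ζ) x
  orbitMax-agree x with j , refl ← A.listing-surjective x =
    trans (suffixMax-unique (cong toℕ ∘ listings-agree) (A.orbitMax-listing-suffixMax j) (B.orbitMax-listing-suffixMax j))
          (cong (orbitMax (σ′ ∘ ζ)) (sym (listings-agree j)))

  nonmax-transfer : ∀ {x} → ¬ A.IsOrbitMax x → ¬ B.IsOrbitMax x
  nonmax-transfer {x} A-nonmax B-max = A-nonmax (trans B-max (sym (orbitMax-agree x)))

  σζ-agree-listing : ∀ j → ¬ A.IsOrbitMax (A.listing j) → σ (ζ (A.listing j)) ≡ σ′ (ζ (A.listing j))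
  σζ-agree-listing j v-nonmax =
    let j′ , j′≡j+1 , Lj′≡σζv = A.listing-next v-nonmax
        j″ , j″≡j+1 , L′j″≡σ′ζv = B.listing-next {j} (subst (¬_ ∘ B.IsOrbitMax) (listings-agree j) (nonmax-transfer v-nonmax))
    in begin
      σ (ζ (A.listing j))    ≡⟨ sym Lj′≡σζv ⟩
      A.listing j′           ≡⟨ listings-agree j′ ⟩
      B.listing j′           ≡⟨ cong B.listing (toℕ-injective (trans j′≡j+1 (sym j″≡j+1))) ⟩
      B.listing j″           ≡⟨ L′j″≡σ′ζv ⟩
      σ′ (ζ (B.listing j))   ≡⟨ cong (σ′ ∘ ζ) (sym (listings-agree j)) ⟩
      σ′ (ζ (A.listing j))   ∎
    where open ≡-Reasoning

  σζ-agree-nonmax : ∀ {v} → ¬ A.IsOrbitMax v → σ (ζ v) ≡ σ′ (ζ v)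
  σζ-agree-nonmax {v} v-nonmax with j , refl ← A.listing-surjective v = σζ-agree-listing j v-nonmax

  -- At an orbit maximum v, the σ′ζ-preimage u of σζ v is v: if u is not a maximum
  -- then σζ u = σ′ζ u = σζ v, and if it is, u and v are both the maximum of one orbit.
  σζ-agree : ∀ v → σ (ζ v) ≡ σ′ (ζ v)
  σζ-agree v with toℕ v ≟ orbitMax (σ ∘ ζ) v
  ... | no v-nonmax = σζ-agree-nonmax v-nonmax
  ... | yes v-max with u , σ′ζu≡σζv ← injective⇒surjective (σζ-injective σ′-injective) (σ (ζ v)) =
    trans (sym σ′ζu≡σζv) (cong (σ′ ∘ ζ) u≡v)
    where
    u≡v : u ≡ v
    u≡v with toℕ u ≟ orbitMax (σ ∘ ζ) u
    ... | no u-nonmax = σζ-injective σ-injective (trans (σζ-agree-nonmax u-nonmax) σ′ζu≡σζv)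
    ... | yes u-max = toℕ-injective (begin
      toℕ u                          ≡⟨ trans u-max (orbitMax-agree u) ⟩
      orbitMax (σ′ ∘ ζ) u            ≡⟨ sym (B.orbitMax-τ u) ⟩
      orbitMax (σ′ ∘ ζ) (σ′ (ζ u))   ≡⟨ cong (orbitMax (σ′ ∘ ζ)) σ′ζu≡σζv ⟩
      orbitMax (σ′ ∘ ζ) (σ (ζ v))    ≡⟨ sym (orbitMax-agree (σ (ζ v))) ⟩
      orbitMax (σ ∘ ζ) (σ (ζ v))     ≡⟨ A.orbitMax-τ v ⟩
      orbitMax (σ ∘ ζ) v             ≡⟨ sym v-max ⟩
      toℕ v                          ∎)
      where open ≡-Reasoning

  listing-determines : σ ≗ σ′
  listing-determines i = begin
    σ i             ≡⟨ cong σ (sym (ζ-ζ⁻¹ i)) ⟩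
    σ (ζ (ζ⁻¹ i))   ≡⟨ σζ-agree (ζ⁻¹ i) ⟩
    σ′ (ζ (ζ⁻¹ i))  ≡⟨ cong σ′ (ζ-ζ⁻¹ i) ⟩
    σ′ i            ∎
    where open ≡-Reasoning

bar-injective : ∀ {m} {σ σ′ : Perm-fun (suc m)} (σ-injective : Injective _≡_ _≡_ σ) (σ′-injective : Injective _≡_ _≡_ σ′) →
                bar σ ≗ bar σ′ → σ ≗ σ′
bar-injective σ-injective σ′-injective bar≗ = listing-determines σ-injective σ′-injective λ j →
  trans (Cycles.listing-hat _ (σζ-injective σ-injective) j)
        (trans (bar≗ j) (sym (Cycles.listing-hat _ (σζ-injective σ′-injective) j)))

module _ {m : ℕ} where

  private
    barVec : Vec (Fin (suc m)) (suc m) → Vec (Fin (suc m)) (suc m)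
    barVec v = tabulate (bar (Vec.lookup v))

    barVec-∈ : ∀ {v} → v ∈ permVectors → barVec v ∈ permVectors
    barVec-∈ {v} v∈ =
      tabulate∈permVectors {f = bar (Vec.lookup v)} (bar-preservesInjective {σ = Vec.lookup v} (∈-permVectors⁻ v∈))

    barVec-injective : ∀ {u v} → u ∈ permVectors → v ∈ permVectors → barVec u ≡ barVec v → u ≡ v
    barVec-injective {u} {v} u∈ v∈ eq = begin
      u                         ≡⟨ sym (tabulate∘lookup u) ⟩
      tabulate (Vec.lookup u)   ≡⟨ tabulate-cong (bar-injective {σ = Vec.lookup u} {Vec.lookup v}
                                     (∈-permVectors⁻ u∈) (∈-permVectors⁻ v∈) bar-u≗bar-v) ⟩
      tabulate (Vec.lookup v)   ≡⟨ tabulate∘lookup v ⟩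
      v                         ∎
      where
      open ≡-Reasoning
      bar-u≗bar-v : bar (Vec.lookup u) ≗ bar (Vec.lookup v)
      bar-u≗bar-v i = trans (sym (lookup∘tabulate (bar (Vec.lookup u)) i))
                            (trans (cong (λ w → Vec.lookup w i) eq) (lookup∘tabulate (bar (Vec.lookup v)) i))

    barVec≡tabulate⇒bar≗ : ∀ v (τ : Perm-fun (suc m)) → barVec v ≡ tabulate τ → bar (Vec.lookup v) ≗ τ
    barVec≡tabulate⇒bar≗ v τ barVec-v≡τ i = begin
      bar (Vec.lookup v) i        ≡⟨ sym (lookup∘tabulate (bar (Vec.lookup v)) i) ⟩
      Vec.lookup (barVec v) i     ≡⟨ cong (λ w → Vec.lookup w i) barVec-v≡τ ⟩
      Vec.lookup (tabulate τ) i   ≡⟨ lookup∘tabulate τ i ⟩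
      τ i                         ∎
      where open ≡-Reasoning

  bar-surjective : (τ : Perm-fun (suc m)) → IsPerm τ → ∃ λ σ → IsPerm σ × bar σ ≗ τ
  bar-surjective τ (τ-injective , _) =
    let v , v∈ , barVec-v≡τ = selfMap-surjective permVectors-unique {f = barVec} barVec-∈ barVec-injective
                                                 (tabulate∈permVectors τ-injective)
    in Vec.lookup v , injective⇒bijective {f = Vec.lookup v} (∈-permVectors⁻ {v = v} v∈) ,
       barVec≡tabulate⇒bar≗ v τ barVec-v≡τ

mainTheorem6 : (n : ℕ) → n ≥ 1 →
    ((σ : Perm-fun n) → IsPerm σ → IsPerm (bar σ))
    × ((σ τ : Perm-fun n) → IsPerm σ → IsPerm τ → bar σ ≗ bar τ → σ ≗ τ)
    × ((τ : Perm-fun n) → IsPerm τ → ∃ λ σ → IsPerm σ × bar σ ≗ τ)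
    × ((σ : Perm-fun n) → IsPerm σ → E σ ≗ M (bar σ))
mainTheorem6 zero ()
mainTheorem6 (suc m) _ =
  (λ σ σ-perm → injective⇒bijective (bar-preservesInjective {σ = σ} (proj₁ σ-perm))) ,
  (λ σ τ σ-perm τ-perm → bar-injective {σ = σ} {τ} (proj₁ σ-perm) (proj₁ τ-perm)) ,
  bar-surjective {m} ,
  (λ σ σ-perm → E≗M∘bar {σ = σ} (proj₁ σ-perm))
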